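{- Let $A\subset\mathbb{N}$ be finite and let $n\in\mathbb{N}$ be a practical number such that $S(n)\subset A$ and $n\notin A$. If every element of $A\setminus S(n)$ is at most $s(n)+1$, then $an\in\Pr(A)$ for every $a\in\mathbb{N}$. In particular, $\Pr(A\cup\{n\})=\Pr(A)$.
   Context: For $n\in\mathbb{N}$, $D(n)$ is the set of positive divisors of $n$, $S(n)=D(n)\setminus\{n\}$ is the set of proper divisors, $\sigma(n)=\sum_{d\in D(n)}d$ and $s(n)=\sigma(n)-n$. For $A\subset\mathbb{N}$, $S_A=\sum_{a\in A}a$ ($S_\emptyset=0$), and $A$ is a practical set if every non-negative integer $k\le S_A$ is a sum of distinct elements of $A$. A number $m\in\mathbb{N}$ is $A$-practical if $D(m)\cap A$ is a practical set, and $\Pr(A)$ is the set of all $A$-practical numbers. A positive integer $n$ is a practical number if $D(n)$ is a practical set. -}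

module Defs where

open import Data.Nat using (ℕ; suc; _≤_; _<_)
open import Data.Nat.Divisibility using (_∣_; _∣?_)
open import Data.List using (List; filter; map; upTo)
open import Data.Nat.ListAction using (sum)
open import Data.List.Relation.Binary.Sublist.Propositional using (_⊆_)
open import Data.Product using (∃; _×_)
open import Relation.Binary.PropositionalEquality using (_≡_)

-- A finite set of positive integers is represented by a duplicate-free list
-- (uniqueness and positivity are imposed as hypotheses in the statement).

S : List ℕ → ℕ
S = sum

-- A is practical: every k ≤ S_A is a sum of distinct elements of A.
-- For a duplicate-free list, "distinct elements of A" = a sublist of A.
IsPracticalSet : List ℕ → Set
IsPracticalSet A = ∀ k → k ≤ S A → ∃ λ B → B ⊆ A × S B ≡ k

D : ℕ → List ℕ
D n = filter (_∣? n) (map suc (upTo n))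



s : ℕ → ℕ
s n = sum (filter (_∣? n) (upTo n))   -- proper divisors of n are {d < n : d ∣ n} (0 ∤ n for n ≥ 1)

DivIn : List ℕ → ℕ → List ℕ
DivIn A m = filter (_∣? m) A

IsAPractical : List ℕ → ℕ → Set
IsAPractical A m = IsPracticalSet (DivIn A m)

IsPractical : ℕ → Set
IsPractical n = IsPracticalSet (D n)

-- Brown's criterion: a list in which every element is at most one more than the sum of the
-- smaller elements is practical; conversely, in a practical list L every x ≤ S L + 1 is at most
-- one more than the sum of the elements of L below x. If n ∣ m, then D(m) ∩ A contains every proper
-- divisor of n. Elements of D(m) ∩ A below n are then controlled, through the practicality of
-- D(n), by the divisors of n below them, and elements above n by s(n) ≥ x - 1. So D(m) ∩ A
-- satisfies Brown's criterion, and n itself can be added to it without losing practicality.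
module Submission where

open import Defs
open import Data.Nat using (ℕ; _≤_; _<_; _+_; _*_)
open import Data.Nat.Divisibility using (_∣_)
open import Data.List using (List; _∷_)
open import Data.List.Membership.Propositional using (_∈_; _∉_)
open import Data.List.Relation.Unary.All using (All)
open import Data.List.Relation.Unary.Unique.Propositional using (Unique)
open import Data.Product using (_×_)
open import Relation.Nullary using (¬_)
open import Function.Bundles using (_⇔_)

open import Data.Nat using (zero; suc; z≤n; s≤s; s≤s⁻¹; _∸_; _<?_; _≤?_)
open import Data.Nat.Divisibility using (_∣?_; ∣-refl; ∣-trans; 0∣⇒≡0; n∣m*n)
open import Data.Nat.ListAction.Properties using (sum-↭)
open import Data.Nat.Properties
open import Algebra.Properties.CommutativeSemigroup +-commutativeSemigroup using (x∙yz≈y∙xz)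
open import Data.List using ([]; filter; map; upTo; length)
open import Data.List.Extrema.Nat using (max; argmax-sel; ⊥≤max; xs≤max)
open import Data.List.Membership.Propositional using (find)
open import Data.List.Membership.Propositional.Properties
  using (∈-filter⁺; ∈-filter⁻; ∈-∃++; ∈-map⁺; ∈-upTo⁺; ∈-upTo⁻)
open import Data.List.Properties using (filter-reject; filter-all)
open import Data.List.Relation.Binary.Permutation.Propositional using (_↭_; refl; prep; swap; trans; ↭-sym)
open import Data.List.Relation.Binary.Permutation.Propositional.Properties using (∈-resp-↭; ↭-length; shift; filter-↭)
open import Data.List.Relation.Binary.Sublist.Propositional using (_⊆_; []; _∷ʳ_; _∷_)
open import Data.List.Relation.Binary.Sublist.Propositional.Properties using (filter⁺; filter-⊆)
open import Data.List.Relation.Unary.All using ([]; _∷_; all?)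
import Data.List.Relation.Unary.All as All
open import Data.List.Relation.Unary.All.Properties using (¬All⇒Any¬)
open import Data.List.Relation.Unary.AllPairs using ([]; _∷_)
open import Data.List.Relation.Unary.Any using (here; there)
import Data.List.Relation.Unary.Unique.Propositional.Properties as Unique
open import Data.Product using (∃; _,_)
open import Data.Sum using (inj₁; inj₂)
open import Data.Empty using (⊥-elim)
open import Relation.Nullary using (yes; no; contradiction)
open import Relation.Binary.Definitions using (tri<; tri≈; tri>)
open import Relation.Binary.PropositionalEquality using (_≡_; refl; sym; cong; subst)
  renaming (trans to ≡-trans)
open import Function.Bundles using (mk⇔)

open ≤-Reasoning

sum-mono-⊆ : ∀ {xs ys} → xs ⊆ ys → S xs ≤ S ys
sum-mono-⊆ [] = z≤n
sum-mono-⊆ (y ∷ʳ τ) = ≤-trans (sum-mono-⊆ τ) (m≤n+m _ y)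
sum-mono-⊆ (refl ∷ τ) = +-monoʳ-≤ _ (sum-mono-⊆ τ)

∈⇒≤sum : ∀ {x xs} → x ∈ xs → x ≤ S xs
∈⇒≤sum {xs = y ∷ _} (here refl) = m≤m+n y _
∈⇒≤sum {xs = y ∷ _} (there x∈) = ≤-trans (∈⇒≤sum x∈) (m≤n+m _ y)

∈⇒↭-∷ : ∀ {x : ℕ} {xs} → x ∈ xs → ∃ λ ys → xs ↭ x ∷ ys
∈⇒↭-∷ x∈ with ∈-∃++ x∈
... | h , t , refl = _ , shift _ h t

sum-mono-∈ : ∀ {xs ys} → Unique xs → (∀ {z} → z ∈ xs → z ∈ ys) → S xs ≤ S ys
sum-mono-∈ [] _ = z≤n
sum-mono-∈ {x ∷ xs} {ys} (x∉xs ∷ unique) xs⊆ys with ∈⇒↭-∷ (xs⊆ys (here refl))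
... | zs , ys↭ = begin
    x + S xs  ≤⟨ +-monoʳ-≤ x (sum-mono-∈ unique xs⊆zs) ⟩
    x + S zs  ≡⟨ sum-↭ ys↭ ⟨
    S ys      ∎
  where
  xs⊆zs : ∀ {z} → z ∈ xs → z ∈ zs
  xs⊆zs z∈ with ∈-resp-↭ ys↭ (xs⊆ys (there z∈))
  ... | here refl   = ⊥-elim (All.lookup x∉xs z∈ refl)
  ... | there z∈zs  = z∈zs

sublist-↭ : ∀ {xs ys B} → xs ↭ ys → B ⊆ xs → ∃ λ B′ → B′ ⊆ ys × S B′ ≡ S B
sublist-↭ refl τ = _ , τ , refl
sublist-↭ (prep x p) (_ ∷ʳ τ) =
  let B′ , τ′ , e = sublist-↭ p τ in B′ , x ∷ʳ τ′ , e
sublist-↭ (prep x p) (refl ∷ τ) =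
  let B′ , τ′ , e = sublist-↭ p τ in x ∷ B′ , refl ∷ τ′ , cong (x +_) e
sublist-↭ (swap x y p) (_ ∷ʳ _ ∷ʳ τ) =
  let B′ , τ′ , e = sublist-↭ p τ in B′ , y ∷ʳ x ∷ʳ τ′ , e
sublist-↭ (swap x y p) (_ ∷ʳ refl ∷ τ) =
  let B′ , τ′ , e = sublist-↭ p τ in y ∷ B′ , refl ∷ x ∷ʳ τ′ , cong (y +_) e
sublist-↭ (swap x y p) (refl ∷ _ ∷ʳ τ) =
  let B′ , τ′ , e = sublist-↭ p τ in x ∷ B′ , y ∷ʳ refl ∷ τ′ , cong (x +_) e
sublist-↭ (swap x y p) (refl ∷ refl ∷ τ) =
  let B′ , τ′ , e = sublist-↭ p τ
  in y ∷ x ∷ B′ , refl ∷ refl ∷ τ′ , ≡-trans (cong (λ t → y + (x + t)) e) (x∙yz≈y∙xz y x _)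
sublist-↭ (trans p q) τ =
  let B₁ , τ₁ , e₁ = sublist-↭ p τ
      B₂ , τ₂ , e₂ = sublist-↭ q τ₁
  in B₂ , τ₂ , ≡-trans e₂ e₁

practical-↭ : ∀ {xs ys} → xs ↭ ys → IsPracticalSet xs → IsPracticalSet ys
practical-↭ p P k k≤ with P k (subst (k ≤_) (sum-↭ (↭-sym p)) k≤)
... | B , τ , e = let B′ , τ′ , e′ = sublist-↭ p τ in B′ , τ′ , ≡-trans e′ e

practical-[] : IsPracticalSet []
practical-[] k k≤0 = [] , [] , sym (n≤0⇒n≡0 k≤0)

practical-∷ : ∀ {x xs} → x ≤ suc (S xs) → IsPracticalSet xs → IsPracticalSet (x ∷ xs)
practical-∷ {x} {xs} x≤ P k k≤ with k ≤? S xs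
... | yes k≤S = let B , τ , e = P k k≤S in B , x ∷ʳ τ , e
... | no k≰S =
  let B , τ , e = P (k ∸ x) (m≤n+o⇒m∸n≤o k x k≤)
  in x ∷ B , refl ∷ τ , ≡-trans (cong (x +_) e) (m+[n∸m]≡n (≤-trans x≤ (≰⇒> k≰S)))

sumBelow : ℕ → List ℕ → ℕ
sumBelow y xs = S (filter (_<? y) xs)

sumBelow≤sum : ∀ y xs → sumBelow y xs ≤ S xs
sumBelow≤sum y xs = sum-mono-⊆ (filter-⊆ (_<? y) xs)

BrownCondition : List ℕ → Set
BrownCondition xs = ∀ {y} → y ∈ xs → y ≤ suc (sumBelow y xs)

brown-remove-max : ∀ {x xs ys} → BrownCondition xs → All (_≤ x) xs → xs ↭ x ∷ ys →
                   BrownCondition ys × x ≤ suc (S ys)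
brown-remove-max {x} {xs} {ys} brown xs≤x xs↭ = brown-ys , x≤
  where
  sumBelow-ys : ∀ {y} → y ∈ xs → sumBelow y xs ≡ sumBelow y ys
  sumBelow-ys y∈ = ≡-trans (sum-↭ (filter-↭ (_<? _) xs↭))
                           (cong S (filter-reject (_<? _) (≤⇒≯ (All.lookup xs≤x y∈))))

  ys⊆xs : ∀ {y} → y ∈ x ∷ ys → y ∈ xs
  ys⊆xs = ∈-resp-↭ (↭-sym xs↭)

  brown-ys : BrownCondition ys
  brown-ys y∈ = subst (λ t → _ ≤ suc t) (sumBelow-ys (ys⊆xs (there y∈))) (brown (ys⊆xs (there y∈)))

  x≤ : x ≤ suc (S ys)
  x≤ = begin
    x                          ≤⟨ brown (ys⊆xs (here refl)) ⟩
    suc (sumBelow x xs)        ≡⟨ cong suc (sumBelow-ys (ys⊆xs (here refl))) ⟩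
    suc (sumBelow x ys)        ≤⟨ s≤s (sumBelow≤sum x ys) ⟩
    suc (S ys)                 ∎

max-∈ : ∀ y zs → max y zs ∈ y ∷ zs
max-∈ y zs with argmax-sel (λ x → x) y zs
... | inj₁ eq = here eq
... | inj₂ m∈ = there m∈

brown⇒practical : ∀ {xs} → BrownCondition xs → IsPracticalSet xs
brown⇒practical {xs} = go xs refl
  where
  go : ∀ {n} xs → length xs ≡ n → BrownCondition xs → IsPracticalSet xs
  go [] _ _ = practical-[]
  go {zero} (_ ∷ _) ()
  go {suc n} (y ∷ zs) len brown with ∈⇒↭-∷ (max-∈ y zs)
  ... | ys , xs↭ =
    let brown-ys , max≤ = brown-remove-max brown (⊥≤max y zs ∷ xs≤max y zs) xs↭
        len-ys = suc-injective (≡-trans (↭-length (↭-sym xs↭)) len)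
    in practical-↭ (↭-sym xs↭) (practical-∷ max≤ (go ys len-ys brown-ys))

practical⇒≤suc-sumBelow : ∀ {x xs} → IsPracticalSet xs → x ≤ suc (S xs) → x ≤ suc (sumBelow x xs)
practical⇒≤suc-sumBelow {x} {xs} P x≤ with x ≤? suc (sumBelow x xs)
... | yes x≤′ = x≤′
... | no x≰ with P (suc (sumBelow x xs)) (s≤s⁻¹ (≤-trans (≰⇒> x≰) x≤))
...   | B , τ , SB≡ with all? (_<? x) B
...     | yes B<x = contradiction sb<sb (n≮n _)
  where
  sb<sb : sumBelow x xs < sumBelow x xs
  sb<sb = begin-strict
    sumBelow x xs        <⟨ n<1+n _ ⟩
    suc (sumBelow x xs)  ≡⟨ SB≡ ⟨
    S B                  ≡⟨ cong S (filter-all (_<? x) B<x) ⟨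
    sumBelow x B         ≤⟨ sum-mono-⊆ (filter⁺ (_<? x) (_<? x) (λ { refl b<x → b<x }) τ) ⟩
    sumBelow x xs        ∎
...     | no B≮x with find (¬All⇒Any¬ (_<? x) B B≮x)
...       | b , b∈B , b≮x = contradiction x<x (n≮n x)
  where
  x<x : x < x
  x<x = begin-strict
    x                    ≤⟨ ≮⇒≥ b≮x ⟩
    b                    ≤⟨ ∈⇒≤sum b∈B ⟩
    S B                  ≡⟨ SB≡ ⟩
    suc (sumBelow x xs)  <⟨ ≰⇒> x≰ ⟩
    x                    ∎

properDivisors : ℕ → List ℕ
properDivisors n = filter (_∣? n) (upTo n)

∈properDivisors⁺ : ∀ {d n} → d ∣ n → d < n → d ∈ properDivisors n
∈properDivisors⁺ {n = n} d∣n d<n = ∈-filter⁺ (_∣? n) (∈-upTo⁺ d<n) d∣n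

∈properDivisors⁻ : ∀ {d n} → d ∈ properDivisors n → d ∣ n × d < n
∈properDivisors⁻ {n = n} d∈ = let d∈upTo , d∣n = ∈-filter⁻ (_∣? n) {xs = upTo n} d∈ in d∣n , ∈-upTo⁻ d∈upTo

properDivisors-unique : ∀ n → Unique (properDivisors n)
properDivisors-unique n = Unique.filter⁺ (_∣? n) (Unique.upTo⁺ n)

∈D⁺ : ∀ {d n} → 1 ≤ n → d ∣ n → d ≤ n → d ∈ D n
∈D⁺ {zero} 1≤n 0∣n _ with 0∣⇒≡0 0∣n
∈D⁺ {zero} () _ _ | refl
∈D⁺ {suc d} {n} _ d∣n d<n = ∈-filter⁺ (_∣? n) (∈-map⁺ suc (∈-upTo⁺ d<n)) d∣n

∈D⁻ : ∀ {d n} → d ∈ D n → d ∣ n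
∈D⁻ {n = n} d∈ = let _ , d∣n = ∈-filter⁻ (_∣? n) {xs = map suc (upTo n)} d∈ in d∣n

D-unique : ∀ n → Unique (D n)
D-unique n = Unique.filter⁺ (_∣? n) (Unique.map⁺ suc-injective (Unique.upTo⁺ n))

s≤sumBelow-D : ∀ {n} → 1 ≤ n → s n ≤ sumBelow n (D n)
s≤sumBelow-D {n} 1≤n = sum-mono-∈ (properDivisors-unique n) λ d∈ →
  let d∣n , d<n = ∈properDivisors⁻ d∈ in ∈-filter⁺ (_<? n) (∈D⁺ 1≤n d∣n (<⇒≤ d<n)) d<n

module DivisorsOfMultiples {A : List ℕ} {n : ℕ} (1≤n : 1 ≤ n) (n-practical : IsPractical n)
    (proper⊆A : ∀ d → d ∣ n → d < n → d ∈ A) (n∉A : n ∉ A)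
    (A≤s+1 : ∀ x → x ∈ A → ¬ (x ∣ n × x < n) → x ≤ s n + 1) where

  A-bounded : ∀ {y} → y ∈ A → y ≤ suc (s n)
  A-bounded {y} y∈A with y ∣? n | y <? n
  ... | yes y∣n | yes y<n = m≤n⇒m≤1+n (∈⇒≤sum (∈properDivisors⁺ y∣n y<n))
  ... | no y∤n  | _       = subst (y ≤_) (+-comm (s n) 1) (A≤s+1 y y∈A λ (y∣n , _) → y∤n y∣n)
  ... | _       | no y≮n  = subst (y ≤_) (+-comm (s n) 1) (A≤s+1 y y∈A λ (_ , y<n) → y≮n y<n)

  module _ {m : ℕ} (n∣m : n ∣ m) where

    sumBelow-D≤sumBelow-DivIn : ∀ {y′ y} → y′ ≤ n → y′ ≤ y → sumBelow y′ (D n) ≤ sumBelow y (DivIn A m)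
    sumBelow-D≤sumBelow-DivIn {y′} {y} y′≤n y′≤y = sum-mono-∈ (Unique.filter⁺ (_<? y′) (D-unique n)) λ z∈ →
      let z∈D , z<y′ = ∈-filter⁻ (_<? y′) {xs = D n} z∈
          z∣n = ∈D⁻ z∈D
          z∈A = proper⊆A _ z∣n (<-≤-trans z<y′ y′≤n)
      in ∈-filter⁺ (_<? y) (∈-filter⁺ (_∣? m) z∈A (∣-trans z∣n n∣m)) (<-≤-trans z<y′ y′≤y)

    DivIn-brown : BrownCondition (DivIn A m)
    DivIn-brown {y} y∈ with ∈-filter⁻ (_∣? m) {xs = A} y∈ | <-cmp y n
    ... | y∈A , _ | tri≈ _ refl _ = ⊥-elim (n∉A y∈A)
    ... | y∈A , _ | tri< y<n _ _ = begin
      y                               ≤⟨ practical⇒≤suc-sumBelow n-practical y≤suc-sum-D ⟩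
      suc (sumBelow y (D n))          ≤⟨ s≤s (sumBelow-D≤sumBelow-DivIn (<⇒≤ y<n) ≤-refl) ⟩
      suc (sumBelow y (DivIn A m))    ∎
      where
      y≤suc-sum-D : y ≤ suc (S (D n))
      y≤suc-sum-D = begin
        y                          ≤⟨ A-bounded y∈A ⟩
        suc (s n)                  ≤⟨ s≤s (s≤sumBelow-D 1≤n) ⟩
        suc (sumBelow n (D n))     ≤⟨ s≤s (sumBelow≤sum n (D n)) ⟩
        suc (S (D n))              ∎
    ... | y∈A , _ | tri> _ _ n<y = begin
      y                               ≤⟨ A-bounded y∈A ⟩
      suc (s n)                       ≤⟨ s≤s (s≤sumBelow-D 1≤n) ⟩
      suc (sumBelow n (D n))          ≤⟨ s≤s (sumBelow-D≤sumBelow-DivIn ≤-refl (<⇒≤ n<y)) ⟩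
      suc (sumBelow y (DivIn A m))    ∎

    DivIn-practical : IsAPractical A m
    DivIn-practical = brown⇒practical DivIn-brown

    n≤suc-sum-DivIn : n ≤ suc (S (DivIn A m))
    n≤suc-sum-DivIn = begin
      n                               ≤⟨ practical⇒≤suc-sumBelow n-practical n≤suc-sum-D ⟩
      suc (sumBelow n (D n))          ≤⟨ s≤s (sumBelow-D≤sumBelow-DivIn ≤-refl ≤-refl) ⟩
      suc (sumBelow n (DivIn A m))    ≤⟨ s≤s (sumBelow≤sum n (DivIn A m)) ⟩
      suc (S (DivIn A m))             ∎
      where
      n≤suc-sum-D : n ≤ suc (S (D n))
      n≤suc-sum-D = m≤n⇒m≤1+n (∈⇒≤sum (∈D⁺ 1≤n ∣-refl ≤-refl))

  insert-n-practical⇔ : ∀ m → IsAPractical (n ∷ A) m ⇔ IsAPractical A m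
  insert-n-practical⇔ m with n ∣? m
  ... | yes n∣m = mk⇔ (λ _ → DivIn-practical n∣m) (practical-∷ (n≤suc-sum-DivIn n∣m))
  ... | no _    = mk⇔ (λ P → P) (λ P → P)

theorem3p23 : (A : List ℕ) → Unique A → All (1 ≤_) A → (n : ℕ) → 1 ≤ n →
    IsPractical n →
    (∀ d → d ∣ n → d < n → d ∈ A) →
    n ∉ A →
    (∀ x → x ∈ A → ¬ (x ∣ n × x < n) → x ≤ s n + 1) →
    (∀ a → 1 ≤ a → IsAPractical A (a * n))
    × (∀ m → 1 ≤ m → (IsAPractical (n ∷ A) m ⇔ IsAPractical A m))
theorem3p23 A _ _ n 1≤n n-practical proper⊆A n∉A A≤s+1 =
    (λ a _ → DivIn-practical (n∣m*n a))
  , (λ m _ → insert-n-practical⇔ m)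
  where open DivisorsOfMultiples 1≤n n-practical proper⊆A n∉A A≤s+1
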